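{- Let $f$ be a two-partition function on an $n$-element ground set $V$, accessed through a value oracle. Given two sets $S,T\subseteq V$ with $|S|=|T|$ but $f(S)\ne f(T)$, the function $f$ (i.e. its value on every subset of $V$) can be determined exactly using a polynomial number of oracle queries.
   Context: A submodular function $f$ on $V$ (i.e. $f(S)+f(T)\ge f(S\cup T)+f(S\cap T)$ for all $S,T$) is a two-partition (2P) function if there is a set $R\subseteq V$ such that for all $S\subseteq V$, the value $f(S)$ depends only on $|S\cap R|$ and $|S\cap(V\setminus R)|$. The set $R$ is not given.
   Formalization: The two-partition function f takes values in ℚ rather than in the reals, so the value oracle returns rational answers. -}

module Defs where

open import Data.Nat using (ℕ; zero; suc; _+_; _*_; _^_)
open import Data.Rational using (ℚ) renaming (_+_ to _+ℚ_; _≤_ to _≤ℚ_)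
open import Data.Fin.Subset using (Subset; _∪_; _∩_; ∁; ∣_∣)
open import Data.Product using (Σ; _×_; ∃; ∃-syntax)
open import Relation.Binary.PropositionalEquality using (_≡_)

-- Set functions on the ground set V = Fin n, real values modelled by ℚ.
SetFun : ℕ → Set
SetFun n = Subset n → ℚ

Submodular : ∀ {n} → SetFun n → Set
Submodular f = ∀ S T → (f (S ∪ T) +ℚ f (S ∩ T)) ≤ℚ (f S +ℚ f T)

DependsOnlyOnSplit : ∀ {n} → Subset n → SetFun n → Set
DependsOnlyOnSplit R f = ∀ S T →
  ∣ S ∩ R ∣ ≡ ∣ T ∩ R ∣ → ∣ S ∩ ∁ R ∣ ≡ ∣ T ∩ ∁ R ∣ → f S ≡ f T

TwoPartition : ∀ {n} → SetFun n → Set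
TwoPartition f = Submodular f × ∃[ R ] DependsOnlyOnSplit R f

-- Adaptive value-oracle algorithms as (rational-branching) query trees.
-- A leaf outputs a complete description of a set function.
data QueryTree (n : ℕ) : Set where
  done : SetFun n → QueryTree n
  ask  : Subset n → (ℚ → QueryTree n) → QueryTree n

queries : ∀ {n} → QueryTree n → SetFun n → ℕ
queries (done _)  f = zero
queries (ask S k) f = suc (queries (k (f S)) f)

output : ∀ {n} → QueryTree n → SetFun n → SetFun n
output (done g)  f = g
output (ask S k) f = output (k (f S)) f

module Submission where

open import Defs
open import Data.Nat using (ℕ; _+_; _*_; _^_; _≤_)
open import Data.Rational using (ℚ)
open import Data.Fin.Subset using (Subset; ∣_∣)
open import Data.Product using (Σ; _×_; ∃; ∃-syntax)
open import Relation.Binary.PropositionalEquality using (_≡_)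
open import Relation.Nullary using (¬_)

open import Data.Nat using (zero; suc; _⊓_; z≤n; s≤s; s≤s⁻¹)
open import Data.Nat.Properties
  using (+-suc; +-identityʳ; ≤-trans; ≤-reflexive; +-monoʳ-≤; +-monoˡ-≤;
         *-monoʳ-≤; n≤1+n; m≤n+m; m≤m*n; n≤0⇒n≡0; 1+n≰n;
         m≤n⇒m⊓n≡m; module ≤-Reasoning)
open import Data.Nat.Tactic.RingSolver using (solve-∀)
open import Data.Bool using (Bool; true; false; not; _∧_; if_then_else_)
open import Data.Fin using (Fin; zero; suc; toℕ; fromℕ<; combine; remQuot)
open import Data.Fin.Properties using (toℕ-fromℕ<; remQuot-combine)
open import Data.Fin.Subset using (_∩_; ∁; ⊤)
open import Data.Fin.Subset.Properties using (∣p∣≤n; ∣p∩q∣≤∣q∣; ∩-identityʳ)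
open import Data.Vec using (Vec; []; _∷_; lookup; tabulate; _[_]≔_)
open import Data.Vec.Properties
  using (lookup-map; lookup-zipWith; lookup-replicate; lookup∘tabulate;
         lookup∘update; lookup∘update′; []≔-lookup; []≔-idempotent;
         tabulate∘lookup; tabulate-cong)
open import Data.Rational.Properties using (_≟_)
open import Data.Product using (_,_; proj₁; proj₂)
open import Data.Sum using (_⊎_; inj₁; inj₂)
open import Data.Empty using (⊥-elim)
open import Function.Bundles using (_⇔_; mk⇔; Equivalence)
open import Relation.Nullary using (does; yes; no)
open import Relation.Binary.PropositionalEquality
  using (refl; sym; trans; cong; cong₂; subst; _≢_; module ≡-Reasoning)

-- The algorithm has three phases.
--  * Walk: starting from C = S, repeatedly trade some x ∈ C ∖ T for some
--    y ∈ T ∖ C.  Since f C ≢ f T, one of at most n trades changes the value,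
--    giving A, x, y ∉ A with f (A + x) ≢ f (A + y); hence x, y lie on different
--    sides of R.
--  * Classify: one query per element z decides whether z is on the side of x:
--    compare f (A + z) with f (A + x) if z ∉ A, and f (A - z + x + y) with
--    f (A + y) if z ∈ A.  This recovers R up to complementation.
--  * Reconstruct: for a known split, query one representative set for each of
--    the (n + 1)² possible pairs of counts.
-- The equalities between values of f are all instances of one exchange lemma:
-- sets that arise from a common base by adding elements on the same side of R
-- have the same value.

bit : Bool → ℕ
bit true  = 1
bit false = 0

bool-dichotomy : ∀ {a b : Bool} → a ≢ b → ∀ c → c ≡ a ⊎ c ≡ b
bool-dichotomy {true}  {true}  a≢b c     = ⊥-elim (a≢b refl)
bool-dichotomy {false} {false} a≢b c     = ⊥-elim (a≢b refl)
bool-dichotomy {true}  {false} _   true  = inj₁ refl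
bool-dichotomy {true}  {false} _   false = inj₂ refl
bool-dichotomy {false} {true}  _   true  = inj₂ refl
bool-dichotomy {false} {true}  _   false = inj₁ refl

lookup-∁ : ∀ {n} (R : Subset n) (i : Fin n) → lookup (∁ R) i ≡ not (lookup R i)
lookup-∁ R i = lookup-map i not R

lookup-∩∁ : ∀ {n} (C T : Subset n) (i : Fin n) → lookup (C ∩ ∁ T) i ≡ true →
  lookup C i ≡ true × lookup T i ≡ false
lookup-∩∁ C T i e = split (lookup C i) (lookup T i) (begin
  lookup C i ∧ not (lookup T i) ≡⟨ cong (lookup C i ∧_) (lookup-∁ T i) ⟨
  lookup C i ∧ lookup (∁ T) i   ≡⟨ lookup-zipWith _∧_ i C (∁ T) ⟨
  lookup (C ∩ ∁ T) i            ≡⟨ e ⟩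
  true                          ∎)
  where
  open ≡-Reasoning
  split : ∀ a b → a ∧ not b ≡ true → a ≡ true × b ≡ false
  split true  false _ = refl , refl
  split true  true  ()
  split false b     ()

update-idle : ∀ {n} {A : Subset n} {i : Fin n} {b : Bool} → lookup A i ≡ b → A [ i ]≔ b ≡ A
update-idle {A = A} {i} refl = []≔-lookup A i

distinct : ∀ {n} {A : Subset n} {i j : Fin n} → lookup A i ≡ true → lookup A j ≡ false → i ≢ j
distinct Ai Aj refl with trans (sym Ai) Aj
... | ()

update-count : ∀ {n} (A M : Subset n) (i : Fin n) →
  ∣ (A [ i ]≔ true) ∩ M ∣ ≡ bit (lookup M i) + ∣ (A [ i ]≔ false) ∩ M ∣
update-count (a ∷ A) (true  ∷ M) zero = refl
update-count (a ∷ A) (false ∷ M) zero = refl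
update-count (a ∷ A) (m ∷ M) (suc i) with a ∧ m
... | true  = trans (cong suc (update-count A M i)) (sym (+-suc _ _))
... | false = update-count A M i

-- U ≈ B ⊕ i: measured against every set M, U has the elements of B plus i.
-- (A record, so that U, B and i can be inferred from a proof.)
record _≈_⊕_ {n} (U B : Subset n) (i : Fin n) : Set where
  constructor extends
  field counts : ∀ M → ∣ U ∩ M ∣ ≡ bit (lookup M i) + ∣ B ∩ M ∣
open _≈_⊕_

insert-extends : ∀ {n} {A : Subset n} {i : Fin n} → lookup A i ≡ false → (A [ i ]≔ true) ≈ A ⊕ i
insert-extends {A = A} {i} Ai = extends λ M →
  subst (λ B → ∣ (A [ i ]≔ true) ∩ M ∣ ≡ bit (lookup M i) + ∣ B ∩ M ∣)
        (update-idle {A = A} {i} Ai) (update-count A M i)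

delete-extends : ∀ {n} {A : Subset n} {i : Fin n} → lookup A i ≡ true → A ≈ (A [ i ]≔ false) ⊕ i
delete-extends {A = A} {i} Ai = extends λ M →
  subst (λ U → ∣ U ∩ M ∣ ≡ bit (lookup M i) + ∣ (A [ i ]≔ false) ∩ M ∣)
        (update-idle {A = A} {i} Ai) (update-count A M i)

extends-swap : ∀ {n} {U V V′ W : Subset n} {i j : Fin n} →
  U ≈ V ⊕ i → V ≈ W ⊕ j → V′ ≈ W ⊕ i → U ≈ V′ ⊕ j
extends-swap {U = U} {V} {V′} {W} {i} {j} U≈ V≈ V′≈ = extends λ M → begin
  ∣ U ∩ M ∣                                       ≡⟨ counts U≈ M ⟩
  bit (lookup M i) + ∣ V ∩ M ∣                    ≡⟨ cong (bit (lookup M i) +_) (counts V≈ M) ⟩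
  bit (lookup M i) + (bit (lookup M j) + ∣ W ∩ M ∣) ≡⟨ swap (bit (lookup M i)) (bit (lookup M j)) _ ⟩
  bit (lookup M j) + (bit (lookup M i) + ∣ W ∩ M ∣) ≡⟨ cong (bit (lookup M j) +_) (sym (counts V′≈ M)) ⟩
  bit (lookup M j) + ∣ V′ ∩ M ∣                   ∎
  where
  open ≡-Reasoning
  swap : ∀ a b c → a + (b + c) ≡ b + (a + c)
  swap = solve-∀

extends-size : ∀ {n} {U B : Subset n} {i : Fin n} → U ≈ B ⊕ i → ∣ U ∣ ≡ suc ∣ B ∣
extends-size {U = U} {B} {i} U≈ = begin
  ∣ U ∣                         ≡⟨ cong ∣_∣ (sym (∩-identityʳ U)) ⟩
  ∣ U ∩ ⊤ ∣                     ≡⟨ counts U≈ ⊤ ⟩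
  bit (lookup ⊤ i) + ∣ B ∩ ⊤ ∣  ≡⟨ cong (λ b → bit b + ∣ B ∩ ⊤ ∣) (lookup-replicate i true) ⟩
  suc ∣ B ∩ ⊤ ∣                 ≡⟨ cong (λ X → suc ∣ X ∣) (∩-identityʳ B) ⟩
  suc ∣ B ∣                     ∎
  where open ≡-Reasoning

no-surplus⇒≡ : ∀ {n} (C T : Subset n) → ∣ C ∩ ∁ T ∣ ≡ 0 → ∣ C ∣ ≡ ∣ T ∣ → C ≡ T
no-surplus⇒≡ C T e s = subset-equal C T e (≤-reflexive (sym s))
  where
  subset-size : ∀ {n} (C T : Subset n) → ∣ C ∩ ∁ T ∣ ≡ 0 → ∣ C ∣ ≤ ∣ T ∣
  subset-size []          []          e = z≤n
  subset-size (true ∷ C)  (true ∷ T)  e = s≤s (subset-size C T e)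
  subset-size (false ∷ C) (true ∷ T)  e = ≤-trans (subset-size C T e) (n≤1+n _)
  subset-size (false ∷ C) (false ∷ T) e = subset-size C T e
  subset-size (true ∷ C)  (false ∷ T) ()
  subset-equal : ∀ {n} (C T : Subset n) → ∣ C ∩ ∁ T ∣ ≡ 0 → ∣ T ∣ ≤ ∣ C ∣ → C ≡ T
  subset-equal []          []          e s = refl
  subset-equal (true ∷ C)  (true ∷ T)  e s = cong (true ∷_) (subset-equal C T e (s≤s⁻¹ s))
  subset-equal (false ∷ C) (true ∷ T)  e s = ⊥-elim (1+n≰n (≤-trans s (subset-size C T e)))
  subset-equal (false ∷ C) (false ∷ T) e s = cong (false ∷_) (subset-equal C T e s)
  subset-equal (true ∷ C)  (false ∷ T) () s

data Pick {n} (v : Subset n) : Set where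
  found : (i : Fin n) → lookup v i ≡ true → Pick v
  none  : ∣ v ∣ ≡ 0 → Pick v

pick : ∀ {n} (v : Subset n) → Pick v
pick []          = none refl
pick (true ∷ v)  = found zero refl
pick (false ∷ v) with pick v
... | found i p = found (suc i) p
... | none p    = none p

∁-involutive : ∀ {n} (R : Subset n) → ∁ (∁ R) ≡ R
∁-involutive []          = refl
∁-involutive (true ∷ R)  = cong (true ∷_) (∁-involutive R)
∁-involutive (false ∷ R) = cong (false ∷_) (∁-involutive R)

∁-split : ∀ {n} {R : Subset n} {f : SetFun n} → DependsOnlyOnSplit R f → DependsOnlyOnSplit (∁ R) f
∁-split {R = R} D S T onR onC =
  D S T (subst (λ X → ∣ S ∩ X ∣ ≡ ∣ T ∩ X ∣) (∁-involutive R) onC) onR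

exchange : ∀ {n} {R : Subset n} {f : SetFun n} → DependsOnlyOnSplit R f →
  ∀ {U V B : Subset n} {i j : Fin n} →
  U ≈ B ⊕ i → V ≈ B ⊕ j → lookup R i ≡ lookup R j → f U ≡ f V
exchange {R = R} D {U} {V} {B} {i} {j} U≈ V≈ Ri≡Rj = D U V (same R Ri≡Rj) (same (∁ R) ∁Ri≡∁Rj)
  where
  same : ∀ M → lookup M i ≡ lookup M j → ∣ U ∩ M ∣ ≡ ∣ V ∩ M ∣
  same M e = trans (counts U≈ M) (trans (cong (λ b → bit b + ∣ B ∩ M ∣) e) (sym (counts V≈ M)))
  ∁Ri≡∁Rj : lookup (∁ R) i ≡ lookup (∁ R) j
  ∁Ri≡∁Rj = trans (lookup-∁ R i) (trans (cong not Ri≡Rj) (sym (lookup-∁ R j)))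

Correct : ∀ {n} → SetFun n → QueryTree n → ℕ → Set
Correct f t B = (queries t f ≤ B) × (∀ U → output t f U ≡ f U)

askAll : ∀ {n} (m : ℕ) → (Fin m → Subset n) → (Vec ℚ m → QueryTree n) → QueryTree n
askAll zero    Q k = k []
askAll (suc m) Q k = ask (Q zero) λ v → askAll m (λ i → Q (suc i)) (λ vs → k (v ∷ vs))

askAll-correct : ∀ {n} (f : SetFun n) m (Q : Fin m → Subset n) (k : Vec ℚ m → QueryTree n) B →
  Correct f (k (tabulate (λ i → f (Q i)))) B → Correct f (askAll m Q k) (m + B)
askAll-correct f zero    Q k B c = c
askAll-correct f (suc m) Q k B c =
  let (q , o) = askAll-correct f m (λ i → Q (suc i)) (λ vs → k (f (Q zero) ∷ vs)) B c
  in s≤s q , o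

canon : ∀ {n} → Subset n → ℕ → ℕ → Subset n
canon []          a       b       = []
canon (true ∷ R)  zero    b       = false ∷ canon R zero b
canon (true ∷ R)  (suc a) b       = true ∷ canon R a b
canon (false ∷ R) a       zero    = false ∷ canon R a zero
canon (false ∷ R) a       (suc b) = true ∷ canon R a b

canon-inside : ∀ {n} (R : Subset n) a b → ∣ canon R a b ∩ R ∣ ≡ a ⊓ ∣ R ∣
canon-inside []          zero    b       = refl
canon-inside []          (suc a) b       = refl
canon-inside (true ∷ R)  zero    b       = canon-inside R zero b
canon-inside (true ∷ R)  (suc a) b       = cong suc (canon-inside R a b)
canon-inside (false ∷ R) a       zero    = canon-inside R a zero
canon-inside (false ∷ R) a       (suc b) = canon-inside R a b

canon-outside : ∀ {n} (R : Subset n) a b → ∣ canon R a b ∩ ∁ R ∣ ≡ b ⊓ ∣ ∁ R ∣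
canon-outside []          a       zero    = refl
canon-outside []          a       (suc b) = refl
canon-outside (true ∷ R)  zero    b       = canon-outside R zero b
canon-outside (true ∷ R)  (suc a) b       = canon-outside R a b
canon-outside (false ∷ R) a       zero    = canon-outside R a zero
canon-outside (false ∷ R) a       (suc b) = cong suc (canon-outside R a b)

-- Reconstruction of f from a known split R: by split-invariance f U depends
-- only on the cell (|U ∩ R|, |U ∖ R|), so one query per cell suffices.
module Reconstruction {n : ℕ} (R : Subset n) where

  Cells : ℕ
  Cells = suc n * suc n

  cell : Subset n → Fin Cells
  cell U = combine (fromℕ< (s≤s (∣p∣≤n (U ∩ R)))) (fromℕ< (s≤s (∣p∣≤n (U ∩ ∁ R))))

  representative : Fin Cells → Subset n
  representative c = canon R (toℕ (proj₁ (remQuot {suc n} (suc n) c))) (toℕ (proj₂ (remQuot {suc n} (suc n) c)))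

  readOff : Vec ℚ Cells → QueryTree n
  readOff answers = done (λ U → lookup answers (cell U))

  reconstruct : QueryTree n
  reconstruct = askAll Cells representative readOff

  representative-cell : ∀ U → representative (cell U) ≡ canon R ∣ U ∩ R ∣ ∣ U ∩ ∁ R ∣
  representative-cell U = begin
    representative (combine a b)              ≡⟨ cong (λ p → canon R (toℕ (proj₁ p)) (toℕ (proj₂ p)))
                                                      (remQuot-combine {suc n} {suc n} a b) ⟩
    canon R (toℕ a) (toℕ b)                   ≡⟨ cong₂ (canon R) (toℕ-fromℕ< _) (toℕ-fromℕ< _) ⟩
    canon R ∣ U ∩ R ∣ ∣ U ∩ ∁ R ∣             ∎
    where
    open ≡-Reasoning
    a = fromℕ< (s≤s (∣p∣≤n (U ∩ R)))
    b = fromℕ< (s≤s (∣p∣≤n (U ∩ ∁ R)))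

  representative-value : ∀ {f : SetFun n} → DependsOnlyOnSplit R f → ∀ U → f (representative (cell U)) ≡ f U
  representative-value D U rewrite representative-cell U =
    D _ U (trans (canon-inside R _ _) (m≤n⇒m⊓n≡m (∣p∩q∣≤∣q∣ U R)))
          (trans (canon-outside R _ _) (m≤n⇒m⊓n≡m (∣p∩q∣≤∣q∣ U (∁ R))))

  reconstruct-correct : ∀ (f : SetFun n) → DependsOnlyOnSplit R f → Correct f reconstruct Cells
  reconstruct-correct f D =
    subst (Correct f reconstruct) (+-identityʳ Cells)
      (askAll-correct f Cells representative readOff 0
        (z≤n , λ U → trans (lookup∘tabulate (λ c → f (representative c)) (cell U)) (representative-value D U)))

open Reconstruction using (reconstruct; reconstruct-correct)

probe : ∀ {n} → Subset n → Fin n → Fin n → Fin n → Subset n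
probe A x y z = if lookup A z then ((A [ z ]≔ false) [ x ]≔ true) [ y ]≔ true else A [ z ]≔ true

reference : ∀ {n} → Subset n → Fin n → ℚ → ℚ → ℚ
reference A z p q = if lookup A z then q else p

sameSide : ∀ {n} → Subset n → Vec ℚ n → ℚ → ℚ → Subset n
sameSide A answers p q = tabulate λ z → does (lookup answers z ≟ reference A z p q)

classify : ∀ {n} → Subset n → Fin n → Fin n → QueryTree n
classify {n} A x y =
  ask (A [ x ]≔ true) λ p → ask (A [ y ]≔ true) λ q →
  askAll n (probe A x y) (λ answers → reconstruct (sameSide A answers p q))

lookup-extensional : ∀ {n} (U V : Subset n) → (∀ z → lookup U z ≡ lookup V z) → U ≡ V
lookup-extensional U V e =
  trans (sym (tabulate∘lookup U)) (trans (tabulate-cong e) (tabulate∘lookup V))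

mark-bit : ∀ {r′ r b : Bool} → (r′ ≡ true) ⇔ (r ≡ b) → r′ ≡ (if b then r else not r)
mark-bit {true}  {r}     {true}  e = sym (Equivalence.to e refl)
mark-bit {true}  {false} {false} e = refl
mark-bit {true}  {true}  {false} e with Equivalence.to e refl
... | ()
mark-bit {false} {false} {true}  e = refl
mark-bit {false} {true}  {false} e = refl
mark-bit {false} {true}  {true}  e with Equivalence.from e refl
... | ()
mark-bit {false} {false} {false} e with Equivalence.from e refl
... | ()

marks-side : ∀ {n} (R′ R : Subset n) (b : Bool) →
  (∀ z → (lookup R′ z ≡ true) ⇔ (lookup R z ≡ b)) → R′ ≡ R ⊎ R′ ≡ ∁ R
marks-side R′ R true  h = inj₁ (lookup-extensional R′ R (λ z → mark-bit (h z)))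
marks-side R′ R false h =
  inj₂ (lookup-extensional R′ (∁ R) (λ z → trans (mark-bit (h z)) (sym (lookup-∁ R z))))

module Classification {n : ℕ} (f : SetFun n) {R : Subset n} (D : DependsOnlyOnSplit R f)
  (A : Subset n) {x y : Fin n} (x∉A : lookup A x ≡ false) (y∉A : lookup A y ≡ false)
  (P≢Q : f (A [ x ]≔ true) ≢ f (A [ y ]≔ true)) where

  P Q : Subset n
  P = A [ x ]≔ true
  Q = A [ y ]≔ true

  sides-differ : lookup R x ≢ lookup R y
  sides-differ e = P≢Q (exchange D (insert-extends x∉A) (insert-extends y∉A) e)

  outside-test : ∀ {z} → lookup A z ≡ false → (f (A [ z ]≔ true) ≡ f P) ⇔ (lookup R z ≡ lookup R x)
  outside-test {z} z∉A = mk⇔ to (exchange D (insert-extends z∉A) (insert-extends x∉A))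
    where
    to : f (A [ z ]≔ true) ≡ f P → lookup R z ≡ lookup R x
    to e with bool-dichotomy sides-differ (lookup R z)
    ... | inj₁ same  = same
    ... | inj₂ other = ⊥-elim (P≢Q (trans (sym e) (exchange D (insert-extends z∉A) (insert-extends y∉A) other)))

  -- an element z ∈ A is classified by comparing A - z + x + y with A + y:
  -- the probe arises from A + y by trading z for x, and from A + x by
  -- trading z for y
  inside-test : ∀ {z} → lookup A z ≡ true →
    (f (((A [ z ]≔ false) [ x ]≔ true) [ y ]≔ true) ≡ f Q) ⇔ (lookup R z ≡ lookup R x)
  inside-test {z} z∈A = mk⇔ to (λ e → sym (exchange D Q≈ W≈Byx e))
    where
    B = A [ z ]≔ false
    x∉B : lookup B x ≡ false
    x∉B = trans (lookup∘update′ (λ x≡z → distinct {A = A} z∈A x∉A (sym x≡z)) A false) x∉A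
    y∉B : lookup B y ≡ false
    y∉B = trans (lookup∘update′ (λ y≡z → distinct {A = A} z∈A y∉A (sym y≡z)) A false) y∉A
    y∉Bx : lookup (B [ x ]≔ true) y ≡ false
    y∉Bx = trans (lookup∘update′ (λ y≡x → P≢Q (cong (λ w → f (A [ w ]≔ true)) (sym y≡x))) B true) y∉B
    A≈ : A ≈ B ⊕ z
    A≈ = delete-extends z∈A
    W≈Bxy : ((B [ x ]≔ true) [ y ]≔ true) ≈ (B [ x ]≔ true) ⊕ y
    W≈Bxy = insert-extends y∉Bx
    W≈Byx : ((B [ x ]≔ true) [ y ]≔ true) ≈ (B [ y ]≔ true) ⊕ x
    W≈Byx = extends-swap W≈Bxy (insert-extends x∉B) (insert-extends y∉B)
    Q≈ : Q ≈ (B [ y ]≔ true) ⊕ z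
    Q≈ = extends-swap (insert-extends y∉A) A≈ (insert-extends y∉B)
    P≈ : P ≈ (B [ x ]≔ true) ⊕ z
    P≈ = extends-swap (insert-extends x∉A) A≈ (insert-extends x∉B)
    to : f ((B [ x ]≔ true) [ y ]≔ true) ≡ f Q → lookup R z ≡ lookup R x
    to e with bool-dichotomy sides-differ (lookup R z)
    ... | inj₁ same  = same
    ... | inj₂ other = ⊥-elim (P≢Q (trans (exchange D P≈ W≈Bxy other) e))

  probe-test : ∀ z → (f (probe A x y z) ≡ reference A z (f P) (f Q)) ⇔ (lookup R z ≡ lookup R x)
  probe-test z with lookup A z in Az
  ... | true  = inside-test Az
  ... | false = outside-test Az

  answers : Vec ℚ n
  answers = tabulate (λ z → f (probe A x y z))

  side : Subset n
  side = sameSide A answers (f P) (f Q)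

  side-marks : ∀ z → (lookup side z ≡ true) ⇔ (lookup R z ≡ lookup R x)
  side-marks z
    rewrite lookup∘tabulate (λ w → does (lookup answers w ≟ reference A w (f P) (f Q))) z
          | lookup∘tabulate (λ w → f (probe A x y w)) z
    with f (probe A x y z) ≟ reference A z (f P) (f Q)
  ... | yes e = mk⇔ (λ _ → Equivalence.to (probe-test z) e) (λ _ → refl)
  ... | no ¬e = mk⇔ (λ ()) (λ e → ⊥-elim (¬e (Equivalence.from (probe-test z) e)))

  side-split : DependsOnlyOnSplit side f
  side-split with marks-side side R (lookup R x) side-marks
  ... | inj₁ side≡R  = subst (λ X → DependsOnlyOnSplit X f) (sym side≡R) D
  ... | inj₂ side≡∁R = subst (λ X → DependsOnlyOnSplit X f) (sym side≡∁R) (∁-split D)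

  -- two queries for P, Q, n probes, and the reconstruction
  classify-correct : Correct f (classify A x y) (2 + (n + Reconstruction.Cells R))
  classify-correct =
    let (q , o) = askAll-correct f n (probe A x y) _ _ (reconstruct-correct side f side-split)
    in s≤s (s≤s q) , o

Finisher : ∀ {n} → SetFun n → (Subset n → Fin n → Fin n → QueryTree n) → ℕ → Set
Finisher {n} f k B = ∀ (A : Subset n) x y → lookup A x ≡ false → lookup A y ≡ false →
  f (A [ x ]≔ true) ≢ f (A [ y ]≔ true) → Correct f (k A x y) B

classify-finishes : ∀ {n} {R : Subset n} (f : SetFun n) → DependsOnlyOnSplit R f →
  Finisher f classify (2 + (n + suc n * suc n))
classify-finishes f D A x y x∉A y∉A P≢Q = Classification.classify-correct f D A x∉A y∉A P≢Q

trade : ∀ {n} → Subset n → Fin n → Fin n → Subset n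
trade C x y = (C [ x ]≔ false) [ y ]≔ true

-- The leaves 'done' are unreachable
-- when f C ≢ f T and |C| = |T|.
walk : ∀ {n} → ℕ → (T C : Subset n) → ℚ → (Subset n → Fin n → Fin n → QueryTree n) → QueryTree n
walk zero       T C v k = done (λ _ → v)
walk (suc fuel) T C v k with pick (C ∩ ∁ T) | pick (T ∩ ∁ C)
... | found x _ | found y _ =
  ask (trade C x y) λ v′ →
    if does (v′ ≟ v) then walk fuel T (trade C x y) v′ k else k (C [ x ]≔ false) x y
... | _ | _ = done (λ _ → v)

module Trade {n : ℕ} {C T : Subset n} {x y : Fin n}
  (x∈C∖T : lookup (C ∩ ∁ T) x ≡ true) (y∈T∖C : lookup (T ∩ ∁ C) y ≡ true) where

  x∈C : lookup C x ≡ true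
  x∈C = proj₁ (lookup-∩∁ C T x x∈C∖T)
  x∉T : lookup T x ≡ false
  x∉T = proj₂ (lookup-∩∁ C T x x∈C∖T)
  y∈T : lookup T y ≡ true
  y∈T = proj₁ (lookup-∩∁ T C y y∈T∖C)
  y∉C : lookup C y ≡ false
  y∉C = proj₂ (lookup-∩∁ T C y y∈T∖C)

  base : Subset n
  base = C [ x ]≔ false

  y∉base : lookup base y ≡ false
  y∉base = trans (lookup∘update′ (λ y≡x → distinct {A = C} x∈C y∉C (sym y≡x)) C false) y∉C

  C≈ : C ≈ base ⊕ x
  C≈ = delete-extends x∈C

  trade≈ : trade C x y ≈ base ⊕ y
  trade≈ = insert-extends y∉base

  trade-size : ∣ trade C x y ∣ ≡ ∣ C ∣
  trade-size = trans (extends-size trade≈) (sym (extends-size C≈))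

  trade-surplus : ∣ C ∩ ∁ T ∣ ≡ suc ∣ trade C x y ∩ ∁ T ∣
  trade-surplus = begin
    ∣ C ∩ ∁ T ∣                             ≡⟨ counts C≈ (∁ T) ⟩
    bit (lookup (∁ T) x) + ∣ base ∩ ∁ T ∣   ≡⟨ cong (λ b → bit b + ∣ base ∩ ∁ T ∣) (trans (lookup-∁ T x) (cong not x∉T)) ⟩
    suc ∣ base ∩ ∁ T ∣                      ≡⟨ cong (λ b → suc (bit b + ∣ base ∩ ∁ T ∣)) (trans (lookup-∁ T y) (cong not y∈T)) ⟨
    suc (bit (lookup (∁ T) y) + ∣ base ∩ ∁ T ∣) ≡⟨ cong suc (counts trade≈ (∁ T)) ⟨
    suc ∣ trade C x y ∩ ∁ T ∣               ∎
    where open ≡-Reasoning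

  restore : base [ x ]≔ true ≡ C
  restore = trans ([]≔-idempotent C x) (update-idle x∈C)

-- Invariant: |C| = |T|, f C ≢ f T and |C ∖ T| ≤ fuel.  Each persisting trade
-- keeps it with one less fuel; a changing trade hands a valid triple to k.
walk-correct : ∀ {n} (f : SetFun n) fuel (T C : Subset n) k B → Finisher f k B →
  ∣ C ∣ ≡ ∣ T ∣ → f C ≢ f T → ∣ C ∩ ∁ T ∣ ≤ fuel → Correct f (walk fuel T C (f C) k) (fuel + B)
walk-correct f zero T C k B finish size≡ fC≢fT surplus≤ =
  ⊥-elim (fC≢fT (cong f (no-surplus⇒≡ C T (n≤0⇒n≡0 surplus≤) size≡)))
walk-correct f (suc fuel) T C k B finish size≡ fC≢fT surplus≤ with pick (C ∩ ∁ T) | pick (T ∩ ∁ C)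
... | none e    | _      = ⊥-elim (fC≢fT (cong f (no-surplus⇒≡ C T e size≡)))
... | found x _ | none e = ⊥-elim (fC≢fT (cong f (sym (no-surplus⇒≡ T C e (sym size≡)))))
... | found x x∈C∖T | found y y∈T∖C with f (trade C x y) ≟ f C
...   | yes same =
  let (q , o) = walk-correct f fuel T (trade C x y) k B finish (trans trade-size size≡)
                  (λ e → fC≢fT (trans (sym same) e)) (s≤s⁻¹ (subst (_≤ suc fuel) trade-surplus surplus≤))
  in s≤s q , o
  where open Trade {C = C} {T} {x} {y} x∈C∖T y∈T∖C
...   | no changed =
  let (q , o) = finish base x y (lookup∘update x C false) y∉base
                  (λ e → changed (sym (trans (sym (cong f restore)) e)))
  in s≤s (≤-trans q (m≤n+m B fuel)) , o
  where open Trade {C = C} {T} {x} {y} x∈C∖T y∈T∖C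

algorithm : (n : ℕ) → Subset n → Subset n → QueryTree n
algorithm n S T = ask S λ v → walk n T S v classify

-- 1 + n + (2 + n + (n + 1)²) = (n + 2)² ≤ 5n² + 5
query-bound : ∀ n → suc (n + (2 + (n + suc n * suc n))) ≤ 5 * n ^ 2 + 5
query-bound n = begin
  suc (n + (2 + (n + suc n * suc n))) ≡⟨ expand n ⟩
  n * n + 4 * n + 4                   ≤⟨ +-monoˡ-≤ 4 (+-monoʳ-≤ (n * n) (*-monoʳ-≤ 4 (n≤n*n n))) ⟩
  n * n + 4 * (n * n) + 4             ≤⟨ n≤1+n _ ⟩
  suc (n * n + 4 * (n * n) + 4)       ≡⟨ collect n ⟩
  5 * n ^ 2 + 5                       ∎
  where
  open ≤-Reasoning
  expand : ∀ n → suc (n + (2 + (n + suc n * suc n))) ≡ n * n + 4 * n + 4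
  expand = solve-∀
  -- n ^ 2 unfolds to n * (n * 1)
  collect : ∀ n → suc (n * n + 4 * (n * n) + 4) ≡ 5 * (n * (n * 1)) + 5
  collect = solve-∀
  n≤n*n : ∀ n → n ≤ n * n
  n≤n*n zero    = z≤n
  n≤n*n (suc m) = m≤m*n (suc m) (suc m)

lemma21 : Σ ((n : ℕ) → Subset n → Subset n → QueryTree n) λ alg →
    Σ ℕ λ c → Σ ℕ λ k →
    (∀ (n : ℕ) (S T : Subset n) (f : SetFun n) →
      TwoPartition f → ∣ S ∣ ≡ ∣ T ∣ → ¬ (f S ≡ f T) →
      (queries (alg n S T) f ≤ c * n ^ k + c)
        × (∀ U → output (alg n S T) f U ≡ f U))
lemma21 = algorithm , 5 , 2 , λ n S T f (_ , _ , D) |S|≡|T| fS≢fT →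
  let (q , o) = walk-correct f n T S classify _ (classify-finishes f D)
                  |S|≡|T| fS≢fT (∣p∣≤n (S ∩ ∁ T))
  in ≤-trans (s≤s q) (query-bound n) , o
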